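{- Let $k$ be a composite positive integer. Then there exist at least two non-equivalent $(k^2+1,2,k,1)$-SEDFs in $\mathbb{Z}_{k^2+1}$.
   Context: For an additive group $G$ of order $n$, an $(n,m,k,\lambda)$-SEDF is a set of $m\ge2$ pairwise disjoint $k$-subsets $A_1,\ldots,A_m$ of $G$ such that for every $i$ the multiset $\{x-y: x\in A_i, y\in \bigcup_{j\neq i}A_j\}$ contains every non-zero element of $G$ exactly $\lambda$ times. Two $(n,m,k,\lambda)$-SEDFs $\{A_1,\ldots,A_m\}$ and $\{A'_1,\ldots,A'_m\}$ over $\mathbb{Z}_n$ are equivalent if there exist an automorphism $\alpha$ of $\mathbb{Z}_n$ (i.e. $x\mapsto ux$ for a unit $u$) and $c\in\mathbb{Z}_n$ such that, after suitable ordering of the sets, $A'_i=\alpha(A_i)+c$ for all $i$. -}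

module Defs where

open import Data.Nat using (ℕ; zero; suc; _+_; _*_; _∸_; _≤_; NonZero)
open import Data.Nat.DivMod using (_mod_)
open import Data.Nat.Coprimality using (Coprime)
open import Data.Fin using (Fin; toℕ; _≟_)
open import Data.Fin.Subset using (Subset; ∣_∣)
open import Data.Fin.Permutation using (Permutation′; _⟨$⟩ʳ_)
open import Data.Bool using (Bool; true; false; _∧_; not; if_then_else_)
open import Data.Vec using (lookup; tabulate)
open import Data.List using (List; map; allFin)
open import Data.Nat.ListAction using (sum)
open import Data.Bool.ListAction using (any)
open import Data.Product using (Σ; _×_; ∃)
open import Relation.Nullary using (¬_)
open import Relation.Nullary.Decidable using (⌊_⌋)
open import Relation.Binary.PropositionalEquality using (_≡_; _≢_)

-- The cyclic group ℤ_n is represented by Fin n; a k-subset is a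
-- Subset n (characteristic vector) of cardinality k.

_-ₙ_ : ∀ {n} .{{_ : NonZero n}} → Fin n → Fin n → Fin n
_-ₙ_ {n} x y = (toℕ x + (n ∸ toℕ y)) mod n

0ₙ : ∀ {n} .{{_ : NonZero n}} → Fin n
0ₙ {n} = 0 mod n

inOthers : ∀ {n m} → (Fin m → Subset n) → Fin m → Fin n → Bool
inOthers {m = m} F i x = any (λ j → not ⌊ i ≟ j ⌋ ∧ lookup (F j) x) (allFin m)

diffCount : ∀ {n} .{{_ : NonZero n}} → Subset n → (Fin n → Bool) → Fin n → ℕ
diffCount {n} A B d =
  sum (map (λ x → sum (map (λ y →
         if lookup A x ∧ B y ∧ ⌊ (x -ₙ y) ≟ d ⌋ then 1 else 0)
       (allFin n))) (allFin n))

record IsSEDF (n m k lam : ℕ) .{{_ : NonZero n}} (F : Fin m → Subset n) : Set where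
  field
    two≤m    : 2 ≤ m
    disjoint : ∀ i j → i ≢ j → ∀ x → lookup (F i) x ≡ true → lookup (F j) x ≡ false
    size     : ∀ i → ∣ F i ∣ ≡ k
    external : ∀ i (d : Fin n) → d ≢ 0ₙ → diffCount (F i) (inOthers F i) d ≡ lam

affineImage : ∀ {n} .{{_ : NonZero n}} → ℕ → Fin n → Subset n → Subset n
affineImage {n} u c A =
  tabulate (λ z → any (λ a → lookup A a ∧ ⌊ ((u * toℕ a + toℕ c) mod n) ≟ z ⌋) (allFin n))

Equivalent : ∀ {n m} .{{_ : NonZero n}} → (Fin m → Subset n) → (Fin m → Subset n) → Set
Equivalent {n} {m} F F' =
  Σ ℕ λ u → Coprime u n × Σ (Fin n) λ c → Σ (Permutation′ m) λ σ →
    ∀ i → F' i ≡ affineImage u c (F (σ ⟨$⟩ʳ i))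

-- Write K = A B with A, B ≥ 1. Every E < K² has a unique mixed-radix expansion
-- E = (i + t A) + (l + s B) K with i < A, t < B, l < B, s < A. Splitting the
-- digits gives the "low" number i + l K and the "high" number t A + s B K, so the
-- set L of low numbers and the set H of high numbers satisfy L + H = [0, K²)
-- with unique representations. Hence {L, −1 − H} is a (K²+1, 2, K, 1)-SEDF in
-- ℤ_{K²+1}: its external differences are exactly 1 + (L + H) and −(1 + (L + H)),
-- i.e. every non-zero residue once.
--
-- For (A, B) = (1, K) this is the classical SEDF {sK}, {−1 − s}, made of two
-- arithmetic progressions of length K; for a proper factorisation A, B ≥ 2 it is
-- a second one. An equivalence would map one of the two classical progressions
-- onto L, but no affine image of a progression of length K lies in L: sums of two
-- low numbers do not wrap around modulo K²+1 and have no carries, so a progression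
-- in L is a progression in each of its two digits, and a progression of A + 1
-- (resp. B + 1) terms with all values below A (resp. B) is constant.
module Submission where

open import Data.Bool using (Bool; true; false; _∧_; if_then_else_; T)
open import Data.Bool.Properties using (∨-identityʳ; ¬-not; T-≡)
open import Data.Fin using (Fin; zero; suc; toℕ; fromℕ<; opposite; _≟_)
import Data.Fin.Properties as Fin
open import Data.Fin.Permutation using (Permutation′; permutation; _⟨$⟩ʳ_)
open import Data.Fin.Properties using (toℕ-injective; toℕ-fromℕ<; toℕ<n; toℕ≤pred[n]; opposite-prop; opposite-involutive)
open import Data.Fin.Subset using (Subset; ∣_∣)
open import Data.List using (map)
import Data.List as List
open import Data.List.Membership.Propositional.Properties using (∈-allFin)
import Data.List.Relation.Unary.Any as Any
open import Data.List.Relation.Unary.Any.Properties using (any⁺)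
import Data.Nat as ℕ
open import Data.Nat using (ℕ; zero; suc; _+_; _*_; _∸_; _≤_; _<_; _/_; _%_; _<?_; NonZero; >-nonZero; >-nonZero⁻¹; nonTrivial⇒n>1; z≤n; s≤s; z<s)
open import Data.Nat.Coprimality using (Coprime; coprime-divisor)
import Data.Nat.Coprimality as Coprime
open import Data.Nat.DivMod
open import Data.Nat.Divisibility using (_∣_; divides; _∣?_; ∣⇒≤; n∣m*n; ∣m+n∣m⇒∣n; quotient; quotient>1; m∣n⇒n≡quotient*m)
open import Data.Nat.Divisibility.Core using (hasNonTrivialDivisor)
open import Data.Nat.ListAction using (sum)
open import Data.Nat.Primality using (Composite)
open import Data.Nat.Properties hiding (_≟_)
open import Data.Nat.Tactic.RingSolver using (solve-∀)
open import Data.Product using (Σ; _×_; _,_; proj₁; proj₂; ∃!; ∃₂; uncurry; swap)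
open import Data.Sum using (inj₁; inj₂)
open import Data.Vec using (lookup; tabulate)
open import Data.Vec.Properties using (lookup∘tabulate)
open import Function using (_∘_; flip; _⇔_; mk⇔; Equivalence)
open import Level using (Level)
open import Relation.Binary.Definitions using (tri<; tri≈; tri>)
open import Relation.Binary.PropositionalEquality
open import Relation.Nullary using (¬_; Dec; yes; no; contradiction)
open import Relation.Nullary.Decidable using (⌊_⌋; _×-dec_)
open import Relation.Unary using (Pred; Decidable)

open import Defs

open import Algebra.Properties.CommutativeMonoid.Sum +-0-commutativeMonoid
  using (sum-syntax; ∑-comm; sum-cong-≗; sum-replicate-zero; sum-permute)
open Equivalence using (to; from)

private
  variable
    ℓ : Level
    P : Set ℓ

ind : Bool → ℕ
ind b = if b then 1 else 0

ind-≢true : ∀ {b} → b ≢ true → ind b ≡ 0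
ind-≢true {true}  b≢true = contradiction refl b≢true
ind-≢true {false} _      = refl

⌊⌋≡true⇔ : (p? : Dec P) → ⌊ p? ⌋ ≡ true ⇔ P
⌊⌋≡true⇔ (yes p) = mk⇔ (λ _ → p) (λ _ → refl)
⌊⌋≡true⇔ (no ¬p) = mk⇔ (λ ()) (λ p → contradiction p ¬p)

∧≡true⇔ : ∀ {a b} → a ∧ b ≡ true ⇔ (a ≡ true × b ≡ true)
∧≡true⇔ {true}  = mk⇔ (λ b → refl , b) proj₂
∧≡true⇔ {false} = mk⇔ (λ ()) (λ ())

∧∧⌊⌋≡true⇔ : ∀ {a b} (p? : Dec P) → a ∧ b ∧ ⌊ p? ⌋ ≡ true ⇔ (a ≡ true × b ≡ true × P)
∧∧⌊⌋≡true⇔ {a = a} {b} p? = mk⇔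
  (λ abp → let a≡ , bp = to ∧≡true⇔ abp
               b≡ , p≡ = to (∧≡true⇔ {b}) bp
           in a≡ , b≡ , to (⌊⌋≡true⇔ p?) p≡)
  (λ (a≡ , b≡ , p) → from (∧≡true⇔ {a}) (a≡ , from (∧≡true⇔ {b}) (b≡ , from (⌊⌋≡true⇔ p?) p)))

lookup-tabulate-⌊⌋ : ∀ {n} {Q : Pred ℕ ℓ} (Q? : Decidable Q) (f : Fin n → ℕ) x →
                     lookup (tabulate (λ x → ⌊ Q? (f x) ⌋)) x ≡ true ⇔ Q (f x)
lookup-tabulate-⌊⌋ Q? f x rewrite lookup∘tabulate (λ x → ⌊ Q? (f x) ⌋) x = ⌊⌋≡true⇔ (Q? (f x))

sum-map-tabulate : ∀ {B : Set} n (g : Fin n → B) (f : B → ℕ) →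
                   sum (map f (List.tabulate g)) ≡ ∑[ i < n ] f (g i)
sum-map-tabulate zero    g f = refl
sum-map-tabulate (suc n) g f = cong (f (g zero) +_) (sum-map-tabulate n (g ∘ suc) f)

diffCount≡∑∑ : ∀ {n} .{{_ : NonZero n}} (S : Subset n) (T : Fin n → Bool) d →
               diffCount S T d ≡ ∑[ x < n ] ∑[ y < n ] ind (lookup S x ∧ T y ∧ ⌊ (x -ₙ y) ≟ d ⌋)
diffCount≡∑∑ {n} S T d =
  trans (sum-map-tabulate n (λ x → x) _) (sum-cong-≗ {n} λ x → sum-map-tabulate n (λ y → y) _)

∣tabulate∣≡∑ : ∀ n (p : Fin n → Bool) → ∣ tabulate p ∣ ≡ ∑[ i < n ] ind (p i)
∣tabulate∣≡∑ zero    p = refl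
∣tabulate∣≡∑ (suc n) p with p zero
... | true  = cong suc (∣tabulate∣≡∑ n (p ∘ suc))
... | false = ∣tabulate∣≡∑ n (p ∘ suc)

∑-const : ∀ n c → ∑[ i < n ] c ≡ n * c
∑-const zero    c = refl
∑-const (suc n) c = cong (c +_) (∑-const n c)

∑-zero : ∀ n {f : Fin n → ℕ} → (∀ i → f i ≡ 0) → ∑[ i < n ] f i ≡ 0
∑-zero n f≗0 = trans (sum-cong-≗ f≗0) (sum-replicate-zero n)

∑-supported : ∀ {n} {f : Fin n → ℕ} i₀ → (∀ i → i ≢ i₀ → f i ≡ 0) → ∑[ i < n ] f i ≡ f i₀
∑-supported {suc n} {f} zero     f≡0 =
  trans (cong (f zero +_) (∑-zero n λ i → f≡0 (suc i) λ ())) (+-identityʳ (f zero))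
∑-supported {suc n} {f} (suc i₀) f≡0 =
  trans (cong (_+ ∑[ i < n ] f (suc i)) (f≡0 zero λ ()))
        (∑-supported i₀ λ i i≢i₀ → f≡0 (suc i) (i≢i₀ ∘ Fin.suc-injective))

∑∑-supported : ∀ {m n} {f : Fin m → Fin n → ℕ} i₀ j₀ →
               (∀ i j → ¬ (i ≡ i₀ × j ≡ j₀) → f i j ≡ 0) →
               ∑[ i < m ] ∑[ j < n ] f i j ≡ f i₀ j₀
∑∑-supported i₀ j₀ f≡0 =
  trans (∑-supported i₀ λ i i≢i₀ → ∑-zero _ λ j → f≡0 i j (i≢i₀ ∘ proj₁))
        (∑-supported j₀ λ j j≢j₀ → f≡0 i₀ j (j≢j₀ ∘ proj₂))

∑∑-ind≡1 : ∀ {n} {R : Fin n → Fin n → Set} (g : Fin n → Fin n → Bool) →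
           (∀ x y → g x y ≡ true ⇔ R x y) → ∃! _≡_ (uncurry R) →
           ∑[ x < n ] ∑[ y < n ] ind (g x y) ≡ 1
∑∑-ind≡1 {R = R} g g⇔R ((x₀ , y₀) , R₀ , unique) =
  trans (∑∑-supported x₀ y₀ λ x y ≢₀ → ind-≢true λ gxy → ≢₀ (only (to (g⇔R x y) gxy)))
        (cong ind (from (g⇔R x₀ y₀) R₀))
  where
  only : ∀ {x y} → R x y → x ≡ x₀ × y ≡ y₀
  only r with unique r
  ... | refl = refl , refl

∑-ind-image : ∀ {n p q} {Q : Pred ℕ ℓ} (Q? : Decidable Q) (h : Fin p → Fin q → ℕ) →
              (∀ i j → h i j < n) → (∀ i j → Q (h i j)) → (∀ {m} → Q m → ∃₂ λ i j → h i j ≡ m) →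
              (∀ {i j i′ j′} → h i j ≡ h i′ j′ → i ≡ i′ × j ≡ j′) →
              ∑[ x < n ] ind ⌊ Q? (toℕ x) ⌋ ≡ p * q
∑-ind-image {n = n} {p} {q} {Q = Q} Q? h h<n Q-h h-onto h-injective = begin
  ∑[ x < n ] ind ⌊ Q? (toℕ x) ⌋               ≡⟨ sum-cong-≗ {n} expand ⟩
  ∑[ x < n ] ∑[ i < p ] ∑[ j < q ] hits i j x ≡⟨ ∑-comm (λ x i → ∑[ j < q ] hits i j x) ⟩
  ∑[ i < p ] ∑[ x < n ] ∑[ j < q ] hits i j x ≡⟨ sum-cong-≗ {p} (λ i → ∑-comm (λ x j → hits i j x)) ⟩
  ∑[ i < p ] ∑[ j < q ] ∑[ x < n ] hits i j x ≡⟨ sum-cong-≗ {p} (λ i → sum-cong-≗ {q} (hit-once i)) ⟩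
  ∑[ i < p ] ∑[ j < q ] 1                     ≡⟨ sum-cong-≗ {p} (λ i → trans (∑-const q 1) (*-identityʳ q)) ⟩
  ∑[ i < p ] q                                ≡⟨ ∑-const p q ⟩
  p * q                                       ∎
  where
  open ≡-Reasoning
  hits : Fin p → Fin q → Fin n → ℕ
  hits i j x = ind ⌊ h i j ℕ.≟ toℕ x ⌋
  hits≡0 : ∀ {i j x} → h i j ≢ toℕ x → hits i j x ≡ 0
  hits≡0 h≢x = ind-≢true (h≢x ∘ to (⌊⌋≡true⇔ (_ ℕ.≟ _)))
  hits≡1 : ∀ {i j x} → h i j ≡ toℕ x → hits i j x ≡ 1
  hits≡1 h≡x = cong ind (from (⌊⌋≡true⇔ (_ ℕ.≟ _)) h≡x)
  hit-once : ∀ i j → ∑[ x < n ] hits i j x ≡ 1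
  hit-once i j = trans (∑-supported (fromℕ< (h<n i j)) λ x x≢ → hits≡0 λ h≡x →
                          x≢ (toℕ-injective (trans (sym h≡x) (sym (toℕ-fromℕ< (h<n i j))))))
                       (hits≡1 (sym (toℕ-fromℕ< (h<n i j))))
  expand : ∀ x → ind ⌊ Q? (toℕ x) ⌋ ≡ ∑[ i < p ] ∑[ j < q ] hits i j x
  expand x with Q? (toℕ x)
  ... | no ¬Qx = sym (∑-zero p λ i → ∑-zero q λ j → hits≡0 λ h≡x → ¬Qx (subst Q h≡x (Q-h i j)))
  ... | yes Qx with h-onto Qx
  ...   | i₀ , j₀ , h₀ = sym (trans (∑∑-supported i₀ j₀ λ i j ≢₀ → hits≡0 λ h≡x →
                                        ≢₀ (h-injective (trans h≡x (sym h₀))))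
                                    (hits≡1 h₀))

-- Digits and modular arithmetic

digits : ∀ {d} .{{_ : NonZero d}} r q → r < d → (r + q * d) % d ≡ r × (r + q * d) / d ≡ q
digits {d} r q r<d =
  trans ([m+kn]%n≡m%n r q d) (m<n⇒m%n≡m r<d) ,
  trans (+-distrib-/-∣ʳ r (n∣m*n q)) (cong₂ _+_ (m<n⇒m/n≡0 r<d) (m*n/n≡m q d))

digits-injective : ∀ {d} .{{_ : NonZero d}} {r r′ q q′} → r < d → r′ < d →
                   r + q * d ≡ r′ + q′ * d → r ≡ r′ × q ≡ q′
digits-injective {d} {r} {r′} {q} {q′} r<d r′<d eq =
  trans (sym (proj₁ (digits r q r<d))) (trans (cong (_% d) eq) (proj₁ (digits r′ q′ r′<d))) ,
  trans (sym (proj₂ (digits r q r<d))) (trans (cong (_/ d) eq) (proj₂ (digits r′ q′ r′<d)))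

digits-< : ∀ {d e r q} → r < d → q < e → r + q * d < e * d
digits-< {d} {e} {r} {q} r<d q<e = begin-strict
  r + q * d <⟨ +-monoˡ-< (q * d) r<d ⟩
  d + q * d ≤⟨ *-monoˡ-≤ d q<e ⟩
  e * d     ∎
  where open ≤-Reasoning

/-<⇒< : ∀ {m d e} .{{_ : NonZero d}} → m / d < e → m < e * d
/-<⇒< {m} {d} m/d<e = subst (_< _) (sym (m≡m%n+[m/n]*n m d)) (digits-< (m%n<n m d) m/d<e)

carry-free : ∀ {a c i j} → a ∣ c → i < a → a ∣ j → j < c → i + j < c
carry-free {a} (divides v refl) i<a (divides t refl) ta<va = digits-< i<a (*-cancelʳ-< a t v ta<va)

+-distrib-% : ∀ m n {d} .{{_ : NonZero d}} → m % d + n % d < d → (m + n) % d ≡ m % d + n % d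
+-distrib-% m n {d} no-carry = trans (%-distribˡ-+ m n d) (m<n⇒m%n≡m no-carry)

[m+w]%d≡m%d⇒d∣w : ∀ {d} .{{_ : NonZero d}} m w → (m + w) % d ≡ m % d → d ∣ w
[m+w]%d≡m%d⇒d∣w {d} m w eq = ∣m+n∣m⇒∣n (divides ((m + w) / d) multiple) (n∣m*n (m / d))
  where
  open ≡-Reasoning
  multiple : m / d * d + w ≡ (m + w) / d * d
  multiple = +-cancelˡ-≡ (m % d) _ _ (begin
    m % d + (m / d * d + w)       ≡⟨ +-assoc (m % d) (m / d * d) w ⟨
    m % d + m / d * d + w         ≡⟨ cong (_+ w) (m≡m%n+[m/n]*n m d) ⟨
    m + w                         ≡⟨ m≡m%n+[m/n]*n (m + w) d ⟩
    (m + w) % d + (m + w) / d * d ≡⟨ cong (_+ (m + w) / d * d) eq ⟩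
    m % d + (m + w) / d * d       ∎)

∣∧<⇒≡0 : ∀ {d w} → d ∣ w → w < d → w ≡ 0
∣∧<⇒≡0 {w = zero}  _   _   = refl
∣∧<⇒≡0 {w = suc w} d∣w w<d = contradiction (∣⇒≤ d∣w) (<⇒≱ w<d)

affine-injective-≤ : ∀ {n u c a b} .{{_ : NonZero n}} → Coprime u n → a ≤ b → b < n →
                     (u * a + c) % n ≡ (u * b + c) % n → a ≡ b
affine-injective-≤ {n} {u} {c} {a} {b} u⊥n a≤b b<n eq = begin
  a           ≡⟨ +-identityʳ a ⟨
  a + 0       ≡⟨ cong (a +_) gap≡0 ⟨
  a + (b ∸ a) ≡⟨ m+[n∸m]≡n a≤b ⟩
  b           ∎
  where
  open ≡-Reasoning
  distribute : ∀ u a w c → u * (a + w) + c ≡ (u * a + c) + u * w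
  distribute = solve-∀
  shift : (u * a + c) + u * (b ∸ a) ≡ u * b + c
  shift = trans (sym (distribute u a (b ∸ a) c)) (cong (λ x → u * x + c) (m+[n∸m]≡n a≤b))
  n∣gap : n ∣ b ∸ a
  n∣gap = coprime-divisor (Coprime.sym u⊥n)
            ([m+w]%d≡m%d⇒d∣w (u * a + c) (u * (b ∸ a)) (trans (cong (_% n) shift) (sym eq)))
  gap≡0 : b ∸ a ≡ 0
  gap≡0 = ∣∧<⇒≡0 n∣gap (≤-<-trans (m∸n≤m b a) b<n)

affine-injective : ∀ {n u c a b} .{{_ : NonZero n}} → Coprime u n → a < n → b < n →
                   (u * a + c) % n ≡ (u * b + c) % n → a ≡ b
affine-injective {a = a} {b} u⊥n a<n b<n eq with ≤-total a b
... | inj₁ a≤b = affine-injective-≤ u⊥n a≤b b<n eq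
... | inj₂ b≤a = sym (affine-injective-≤ u⊥n b≤a a<n (sym eq))

affine-respects-sums : ∀ {n} .{{_ : NonZero n}} u c {a b a′ b′} → a + b ≡ a′ + b′ →
                       ((u * a + c) % n + (u * b + c) % n) % n ≡ ((u * a′ + c) % n + (u * b′ + c) % n) % n
affine-respects-sums {n} u c {a} {b} {a′} {b′} eq = begin
  ((u * a + c) % n + (u * b + c) % n) % n   ≡⟨ %-distribˡ-+ (u * a + c) (u * b + c) n ⟨
  ((u * a + c) + (u * b + c)) % n           ≡⟨ cong (_% n) (collect u c a b) ⟩
  (u * (a + b) + (c + c)) % n               ≡⟨ cong (λ x → (u * x + (c + c)) % n) eq ⟩
  (u * (a′ + b′) + (c + c)) % n             ≡⟨ cong (_% n) (collect u c a′ b′) ⟨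
  ((u * a′ + c) + (u * b′ + c)) % n         ≡⟨ %-distribˡ-+ (u * a′ + c) (u * b′ + c) n ⟩
  ((u * a′ + c) % n + (u * b′ + c) % n) % n ∎
  where
  open ≡-Reasoning
  collect : ∀ u c a b → (u * a + c) + (u * b + c) ≡ u * (a + b) + (c + c)
  collect = solve-∀

affineImage-∋ : ∀ {n} .{{_ : NonZero n}} u c (S : Subset n) x → lookup S x ≡ true →
                lookup (affineImage u c S) ((u * toℕ x + toℕ c) mod n) ≡ true
affineImage-∋ {n} u c S x x∈S =
  trans (lookup∘tabulate _ z) (to T-≡ (any⁺ _ (Any.map (λ { refl → x↦z }) (∈-allFin x))))
  where
  z = (u * toℕ x + toℕ c) mod n
  x↦z : T (lookup S x ∧ ⌊ ((u * toℕ x + toℕ c) mod n) ≟ z ⌋)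
  x↦z = from T-≡ (from ∧≡true⇔ (x∈S , from (⌊⌋≡true⇔ (z ≟ z)) refl))

∸+∸-wrap : ∀ {N a b} → a + b ≤ N → suc ((N ∸ b) + (N ∸ a)) ≡ (N ∸ (a + b)) + suc N
∸+∸-wrap {N} {a} {b} a+b≤N = begin
  suc ((N ∸ b) + (N ∸ a)) ≡⟨ cong₂ (λ u v → suc (u + v)) N∸b N∸a ⟩
  suc ((r + a) + (r + b)) ≡⟨ regroup r a b ⟩
  r + suc (r + (a + b))   ≡⟨ cong (λ t → r + suc t) r+a+b≡N ⟩
  r + suc N               ∎
  where
  open ≡-Reasoning
  r = N ∸ (a + b)
  r+a+b≡N : r + (a + b) ≡ N
  r+a+b≡N = m∸n+n≡m a+b≤N
  regroup : ∀ r a b → suc ((r + a) + (r + b)) ≡ r + suc (r + (a + b))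
  regroup = solve-∀
  N∸b : N ∸ b ≡ r + a
  N∸b = trans (cong (_∸ b) (trans (sym r+a+b≡N) (sym (+-assoc r a b)))) (m+n∸n≡m (r + a) b)
  N∸a : N ∸ a ≡ r + b
  N∸a = trans (cong (_∸ a) (trans (sym r+a+b≡N) (trans (cong (r +_) (+-comm a b)) (sym (+-assoc r b a)))))
              (m+n∸n≡m (r + b) a)

-- Arithmetic progressions

∸-AP : ∀ {N} s → 2 + s ≤ N → (N ∸ (2 + s)) + (N ∸ s) ≡ (N ∸ (1 + s)) + (N ∸ (1 + s))
∸-AP {N} s 2+s≤N = begin
  r + (N ∸ s)                   ≡⟨ cong (r +_) (trans (∸-step (<⇒≤ 2+s≤N)) (cong suc (∸-step 2+s≤N))) ⟩
  r + suc (suc r)               ≡⟨ +-suc r (suc r) ⟩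
  suc r + suc r                 ≡⟨ cong₂ _+_ (∸-step 2+s≤N) (∸-step 2+s≤N) ⟨
  (N ∸ (1 + s)) + (N ∸ (1 + s)) ∎
  where
  open ≡-Reasoning
  r = N ∸ (2 + s)
  ∸-step : ∀ {s} → 1 + s ≤ N → N ∸ s ≡ suc (N ∸ (1 + s))
  ∸-step = +-∸-assoc 1

module _ (f : ℕ → ℕ) {M : ℕ} (ap : ∀ s → 2 + s ≤ M → f (2 + s) + f s ≡ f (1 + s) + f (1 + s)) where

  AP-linear : ∀ s → s < M → f (1 + s) + f 0 ≡ f s + f 1
  AP-linear zero    _      = +-comm (f 1) (f 0)
  AP-linear (suc s) 2+s≤M = +-cancelʳ-≡ (f s) _ _ (begin
    f (2 + s) + f 0 + f s         ≡⟨ exchange (f (2 + s)) (f 0) (f s) ⟩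
    f (2 + s) + f s + f 0         ≡⟨ cong (_+ f 0) (ap s 2+s≤M) ⟩
    f (1 + s) + f (1 + s) + f 0   ≡⟨ +-assoc (f (1 + s)) (f (1 + s)) (f 0) ⟩
    f (1 + s) + (f (1 + s) + f 0) ≡⟨ cong (f (1 + s) +_) (AP-linear s (<⇒≤ 2+s≤M)) ⟩
    f (1 + s) + (f s + f 1)       ≡⟨ exchange′ (f (1 + s)) (f s) (f 1) ⟩
    f (1 + s) + f 1 + f s         ∎)
    where
    open ≡-Reasoning
    exchange : ∀ x y z → x + y + z ≡ x + z + y
    exchange = solve-∀
    exchange′ : ∀ x y z → x + (y + z) ≡ x + z + y
    exchange′ = solve-∀

  AP-increasing : f 0 < f 1 → ∀ s → s ≤ M → s ≤ f s
  AP-increasing _     zero    _     = z≤n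
  AP-increasing f₀<f₁ (suc s) 1+s≤M = ≤-trans (s≤s (AP-increasing f₀<f₁ s (<⇒≤ 1+s≤M))) step
    where
    open ≤-Reasoning
    step : f s < f (1 + s)
    step = +-cancelʳ-≤ (f 0) _ _ (begin
      suc (f s) + f 0 ≡⟨ +-suc (f s) (f 0) ⟨
      f s + suc (f 0) ≤⟨ +-monoʳ-≤ (f s) f₀<f₁ ⟩
      f s + f 1       ≡⟨ AP-linear s 1+s≤M ⟨
      f (1 + s) + f 0 ∎)

  AP-decreasing : f 1 < f 0 → ∀ s → s ≤ M → f s + s ≤ f 0
  AP-decreasing _     zero    _     = ≤-reflexive (+-identityʳ (f 0))
  AP-decreasing f₁<f₀ (suc s) 1+s≤M = begin
    f (1 + s) + suc s   ≡⟨ +-suc (f (1 + s)) s ⟩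
    suc (f (1 + s)) + s ≤⟨ +-monoˡ-≤ s step ⟩
    f s + s             ≤⟨ AP-decreasing f₁<f₀ s (<⇒≤ 1+s≤M) ⟩
    f 0                 ∎
    where
    open ≤-Reasoning
    step : f (1 + s) < f s
    step = +-cancelʳ-≤ (f 0) _ _ (begin
      suc (f (1 + s) + f 0) ≡⟨ cong suc (AP-linear s 1+s≤M) ⟩
      suc (f s + f 1)       ≤⟨ +-monoʳ-< (f s) f₁<f₀ ⟩
      f s + f 0             ∎)

  bounded-AP-constant : (∀ s → s ≤ M → f s < M) → f 1 ≡ f 0
  bounded-AP-constant f<M with <-cmp (f 0) (f 1)
  ... | tri≈ _ f₀≡f₁ _ = sym f₀≡f₁
  ... | tri< f₀<f₁ _ _ = contradiction (AP-increasing f₀<f₁ M ≤-refl) (<⇒≱ (f<M M ≤-refl))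
  ... | tri> _ _ f₁<f₀ =
    contradiction (≤-trans (m≤n+m M (f M)) (AP-decreasing f₁<f₀ M ≤-refl)) (<⇒≱ (f<M 0 z≤n))

-- Low and high numbers

module MixedRadix (K A B : ℕ) {{_ : NonZero K}} {{_ : NonZero A}} {{_ : NonZero B}} (A*B≡K : A * B ≡ K) where

  B*A≡K : B * A ≡ K
  B*A≡K = trans (*-comm B A) A*B≡K

  A∣K : A ∣ K
  A∣K = divides B (sym B*A≡K)

  B∣K : B ∣ K
  B∣K = divides A (sym A*B≡K)

  IsLow : Pred ℕ _
  IsLow x = x % K < A × x / K < B

  IsHigh : Pred ℕ _
  IsHigh m = (A ∣ m % K) × (B ∣ m / K) × m < K * K

  IsLow? : Decidable IsLow
  IsLow? x = x % K <? A ×-dec x / K <? B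

  IsHigh? : Decidable IsHigh
  IsHigh? m = (A ∣? m % K) ×-dec (B ∣? m / K) ×-dec m <? K * K

  lowPart : ℕ → ℕ
  lowPart E = E % K % A + E / K % B * K

  highPart : ℕ → ℕ
  highPart E = E % K / A * A + E / K / B * B * K

  lowPart+highPart : ∀ E → lowPart E + highPart E ≡ E
  lowPart+highPart E = begin
    lowPart E + highPart E
      ≡⟨ regroup (E % K % A) (E / K % B) (E % K / A * A) (E / K / B * B) K ⟩
    (E % K % A + E % K / A * A) + (E / K % B + E / K / B * B) * K
      ≡⟨ cong₂ (λ r q → r + q * K) (m≡m%n+[m/n]*n (E % K) A) (m≡m%n+[m/n]*n (E / K) B) ⟨
    E % K + E / K * K
      ≡⟨ m≡m%n+[m/n]*n E K ⟨
    E ∎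
    where
    open ≡-Reasoning
    regroup : ∀ a b c d K → (a + b * K) + (c + d * K) ≡ (a + c) + (b + d) * K
    regroup = solve-∀

  *A<K : ∀ {t} → t < B → t * A < K
  *A<K {t} t<B = subst (t * A <_) B*A≡K (*-monoˡ-< A t<B)

  digits-isLow : ∀ {i l} → i < A → l < B → IsLow (i + l * K)
  digits-isLow {i} {l} i<A l<B = subst (_< A) (sym (proj₁ ds)) i<A , subst (_< B) (sym (proj₂ ds)) l<B
    where ds = digits i l (<-≤-trans i<A (∣⇒≤ A∣K))

  digits-isHigh : ∀ {t s} → t < B → s < A → IsHigh (t * A + s * B * K)
  digits-isHigh {t} {s} t<B s<A =
    subst (A ∣_) (sym (proj₁ ds)) (n∣m*n t) ,
    subst (B ∣_) (sym (proj₂ ds)) (n∣m*n s) ,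
    digits-< (*A<K t<B) (subst (s * B <_) A*B≡K (*-monoˡ-< B s<A))
    where ds = digits (t * A) (s * B) (*A<K t<B)

  isLow⇒<K*K : ∀ {x} → IsLow x → x < K * K
  isLow⇒<K*K (_ , x/K<B) = /-<⇒< (<-≤-trans x/K<B (∣⇒≤ B∣K))

  lowPart-isLow : ∀ E → IsLow (lowPart E)
  lowPart-isLow E = digits-isLow (m%n<n (E % K) A) (m%n<n (E / K) B)

  highPart-isHigh : ∀ {E} → E < K * K → IsHigh (highPart E)
  highPart-isHigh {E} E<K*K = digits-isHigh
    (m<n*o⇒m/o<n (subst (E % K <_) (sym B*A≡K) (m%n<n E K)))
    (m<n*o⇒m/o<n (subst (E / K <_) (sym A*B≡K) (m<n*o⇒m/o<n E<K*K)))

  low+high-no-carry : ∀ {x m} → IsLow x → IsHigh m → x % K + m % K < K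
  low+high-no-carry (i<A , _) (A∣r , _) = carry-free A∣K i<A A∣r (m%n<n _ K)

  low+high-quotient : ∀ {x m} → IsLow x → IsHigh m → (x + m) / K ≡ x / K + m / K
  low+high-quotient {x} {m} low high = +-distrib-/ x m (low+high-no-carry low high)

  low+high-remainder : ∀ {x m} → IsLow x → IsHigh m → (x + m) % K ≡ x % K + m % K
  low+high-remainder {x} {m} low high = +-distrib-% x m (low+high-no-carry low high)

  low+high<K*K : ∀ {x m} → IsLow x → IsHigh m → x + m < K * K
  low+high<K*K low@(_ , l<B) high@(_ , B∣q , m<K*K) =
    /-<⇒< (subst (_< K) (sym (low+high-quotient low high))
            (carry-free B∣K l<B B∣q (m<n*o⇒m/o<n m<K*K)))

  lowPart-low+high : ∀ {x m} → IsLow x → IsHigh m → lowPart (x + m) ≡ x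
  lowPart-low+high {x} {m} low@(i<A , l<B) high@(divides t r≡tA , divides s q≡sB , _) = begin
    (x + m) % K % A + (x + m) / K % B * K
      ≡⟨ cong₂ (λ r q → r % A + q % B * K) (low+high-remainder low high) (low+high-quotient low high) ⟩
    (x % K + m % K) % A + (x / K + m / K) % B * K
      ≡⟨ cong₂ (λ r q → (x % K + r) % A + (x / K + q) % B * K) r≡tA q≡sB ⟩
    (x % K + t * A) % A + (x / K + s * B) % B * K
      ≡⟨ cong₂ (λ r q → r + q * K) (proj₁ (digits (x % K) t i<A)) (proj₁ (digits (x / K) s l<B)) ⟩
    x % K + x / K * K
      ≡⟨ m≡m%n+[m/n]*n x K ⟨
    x ∎
    where open ≡-Reasoning

  low+high-unique : ∀ {x m x′ m′} → IsLow x → IsHigh m → IsLow x′ → IsHigh m′ →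
                    x + m ≡ x′ + m′ → x ≡ x′ × m ≡ m′
  low+high-unique {x} {m} {x′} {m′} low high low′ high′ eq =
    x≡x′ , +-cancelˡ-≡ x m m′ (trans eq (cong (_+ m′) (sym x≡x′)))
    where
    x≡x′ : x ≡ x′
    x≡x′ = trans (sym (lowPart-low+high low high)) (trans (cong lowPart eq) (lowPart-low+high low′ high′))

  module _ (2≤A : 2 ≤ A) (2≤B : 2 ≤ B) where

    private
      double≤ : ∀ a b → 2 ≤ b → a + a ≤ b * a
      double≤ a b 2≤b = subst (_≤ b * a) (cong (a +_) (+-identityʳ a)) (*-monoˡ-≤ a 2≤b)

      half<K : ∀ {a} → 0 < a → a + a ≤ K → a < K
      half<K {a} 0<a a+a≤K = <-≤-trans (m<m+n a 0<a) a+a≤K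

    A+A≤K : A + A ≤ K
    A+A≤K = subst (A + A ≤_) B*A≡K (double≤ A B 2≤B)

    B+B≤K : B + B ≤ K
    B+B≤K = subst (B + B ≤_) A*B≡K (double≤ B A 2≤A)

    low+low-remainder : ∀ {z z′} → IsLow z → IsLow z′ → (z + z′) % K ≡ z % K + z′ % K
    low+low-remainder {z} {z′} (i<A , _) (i′<A , _) =
      +-distrib-% z z′ (<-≤-trans (+-mono-< i<A i′<A) A+A≤K)

    low+low-quotient : ∀ {z z′} → IsLow z → IsLow z′ → (z + z′) / K ≡ z / K + z′ / K
    low+low-quotient {z} {z′} (i<A , _) (i′<A , _) =
      +-distrib-/ z z′ (<-≤-trans (+-mono-< i<A i′<A) A+A≤K)

    low+low<K*K : ∀ {z z′} → IsLow z → IsLow z′ → z + z′ < K * K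
    low+low<K*K low@(_ , l<B) low′@(_ , l′<B) =
      /-<⇒< (subst (_< K) (sym (low+low-quotient low low′)) (<-≤-trans (+-mono-< l<B l′<B) B+B≤K))

    low-AP-constant : (Z : ℕ → ℕ) → (∀ s → s < K → IsLow (Z s)) →
                      (∀ s → 2 + s < K → Z (2 + s) + Z s ≡ Z (1 + s) + Z (1 + s)) → Z 1 ≡ Z 0
    low-AP-constant Z low ap = begin
      Z 1                   ≡⟨ m≡m%n+[m/n]*n (Z 1) K ⟩
      Z 1 % K + Z 1 / K * K ≡⟨ cong₂ (λ r q → r + q * K) remainders-constant quotients-constant ⟩
      Z 0 % K + Z 0 / K * K ≡⟨ m≡m%n+[m/n]*n (Z 0) K ⟨
      Z 0                   ∎
      where
      open ≡-Reasoning
      digit-constant : (δ : ℕ → ℕ) {M : ℕ} → M < K → (∀ {z} → IsLow z → δ z < M) →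
                       (∀ {z z′} → IsLow z → IsLow z′ → δ (z + z′) ≡ δ z + δ z′) → δ (Z 1) ≡ δ (Z 0)
      digit-constant δ {M} M<K δ<M additive =
        bounded-AP-constant (δ ∘ Z) δZ-AP (λ s s≤M → δ<M (low s (≤-<-trans s≤M M<K)))
        where
        δZ-AP : ∀ s → 2 + s ≤ M → δ (Z (2 + s)) + δ (Z s) ≡ δ (Z (1 + s)) + δ (Z (1 + s))
        δZ-AP s 2+s≤M = begin
          δ (Z (2 + s)) + δ (Z s)       ≡⟨ additive (low (2 + s) 2+s<K) (low s s<K) ⟨
          δ (Z (2 + s) + Z s)           ≡⟨ cong δ (ap s 2+s<K) ⟩
          δ (Z (1 + s) + Z (1 + s))     ≡⟨ additive (low (1 + s) 1+s<K) (low (1 + s) 1+s<K) ⟩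
          δ (Z (1 + s)) + δ (Z (1 + s)) ∎
          where
          2+s<K : 2 + s < K
          2+s<K = ≤-<-trans 2+s≤M M<K
          1+s<K : 1 + s < K
          1+s<K = <-trans (n<1+n (1 + s)) 2+s<K
          s<K : s < K
          s<K = <-trans (n<1+n s) 1+s<K
      remainders-constant : Z 1 % K ≡ Z 0 % K
      remainders-constant = digit-constant (_% K) (half<K (>-nonZero⁻¹ A) A+A≤K) proj₁ low+low-remainder
      quotients-constant : Z 1 / K ≡ Z 0 / K
      quotients-constant = digit-constant (_/ K) (half<K (>-nonZero⁻¹ B) B+B≤K) proj₂ low+low-quotient

-- The difference family {L, −1 − H}

module Construction (K A B : ℕ) {{_ : NonZero K}} {{_ : NonZero A}} {{_ : NonZero B}} (A*B≡K : A * B ≡ K) where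

  open MixedRadix K A B A*B≡K public

  n : ℕ
  n = suc (K * K)

  -- opposite y is −1 − y in ℤ_n, so High is −1 − H for the set H of high numbers.
  neg : Fin n → ℕ
  neg y = toℕ (opposite y)

  Low : Subset n
  Low = tabulate (λ x → ⌊ IsLow? (toℕ x) ⌋)

  High : Subset n
  High = tabulate (λ y → ⌊ IsHigh? (neg y) ⌋)

  family : Fin 2 → Subset n
  family zero       = Low
  family (suc zero) = High

  ∈Low⇔ : ∀ x → lookup Low x ≡ true ⇔ IsLow (toℕ x)
  ∈Low⇔ = lookup-tabulate-⌊⌋ IsLow? toℕ

  ∈High⇔ : ∀ y → lookup High y ≡ true ⇔ IsHigh (neg y)
  ∈High⇔ = lookup-tabulate-⌊⌋ IsHigh? neg

  neg≡K*K∸toℕ : ∀ y → neg y ≡ K * K ∸ toℕ y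
  neg≡K*K∸toℕ = opposite-prop

  toℕ≡K*K∸neg : ∀ y → toℕ y ≡ K * K ∸ neg y
  toℕ≡K*K∸neg y = trans (cong toℕ (sym (opposite-involutive y))) (neg≡K*K∸toℕ (opposite y))

  toℕ+neg≡K*K : ∀ y → toℕ y + neg y ≡ K * K
  toℕ+neg≡K*K y = trans (cong (toℕ y +_) (neg≡K*K∸toℕ y)) (m+[n∸m]≡n (toℕ≤pred[n] y))

  neg-injective : ∀ {x y} → neg x ≡ neg y → x ≡ y
  neg-injective {x} {y} eq =
    trans (sym (opposite-involutive x)) (trans (cong opposite (toℕ-injective eq)) (opposite-involutive y))

  Low∩High≡∅ : ∀ x → lookup Low x ≡ true → lookup High x ≢ true
  Low∩High≡∅ x x∈Low x∈High =
    <-irrefl (toℕ+neg≡K*K x) (low+high<K*K (to (∈Low⇔ x) x∈Low) (to (∈High⇔ x) x∈High))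

  ∣Low∣≡K : ∣ Low ∣ ≡ K
  ∣Low∣≡K = begin
    ∣ Low ∣                           ≡⟨ ∣tabulate∣≡∑ n (λ x → ⌊ IsLow? (toℕ x) ⌋) ⟩
    ∑[ x < n ] ind ⌊ IsLow? (toℕ x) ⌋ ≡⟨ ∑-ind-image IsLow? h h<n h-isLow h-onto h-injective ⟩
    A * B                             ≡⟨ A*B≡K ⟩
    K                                 ∎
    where
    open ≡-Reasoning
    h : Fin A → Fin B → ℕ
    h i l = toℕ i + toℕ l * K
    h-isLow : ∀ i l → IsLow (h i l)
    h-isLow i l = digits-isLow (toℕ<n i) (toℕ<n l)
    h<n : ∀ i l → h i l < n
    h<n i l = m<n⇒m<1+n (isLow⇒<K*K (h-isLow i l))
    h-onto : ∀ {m} → IsLow m → ∃₂ λ i l → h i l ≡ m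
    h-onto {m} (r<A , q<B) = fromℕ< r<A , fromℕ< q<B ,
      trans (cong₂ (λ r q → r + q * K) (toℕ-fromℕ< r<A) (toℕ-fromℕ< q<B)) (sym (m≡m%n+[m/n]*n m K))
    i<K : (i : Fin A) → toℕ i < K
    i<K i = <-≤-trans (toℕ<n i) (∣⇒≤ A∣K)
    h-injective : ∀ {i l i′ l′} → h i l ≡ h i′ l′ → i ≡ i′ × l ≡ l′
    h-injective {i} {i′ = i′} eq with digits-injective (i<K i) (i<K i′) eq
    ... | i≡i′ , l≡l′ = toℕ-injective i≡i′ , toℕ-injective l≡l′

  ∣High∣≡K : ∣ High ∣ ≡ K
  ∣High∣≡K = begin
    ∣ High ∣                                      ≡⟨ ∣tabulate∣≡∑ n (λ y → ⌊ IsHigh? (neg y) ⌋) ⟩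
    ∑[ y < n ] ind ⌊ IsHigh? (toℕ (opposite y)) ⌋ ≡⟨ sum-permute (λ y → ind ⌊ IsHigh? (toℕ y) ⌋) opposite-permutation ⟨
    ∑[ y < n ] ind ⌊ IsHigh? (toℕ y) ⌋            ≡⟨ ∑-ind-image IsHigh? h h<n h-isHigh h-onto h-injective ⟩
    B * A                                         ≡⟨ B*A≡K ⟩
    K                                             ∎
    where
    open ≡-Reasoning
    opposite-permutation : Permutation′ n
    opposite-permutation = permutation opposite opposite opposite-involutive opposite-involutive
    h : Fin B → Fin A → ℕ
    h t s = toℕ t * A + toℕ s * B * K
    h-isHigh : ∀ t s → IsHigh (h t s)
    h-isHigh t s = digits-isHigh (toℕ<n t) (toℕ<n s)
    h<n : ∀ t s → h t s < n
    h<n t s = m<n⇒m<1+n (proj₂ (proj₂ (h-isHigh t s)))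
    h-onto : ∀ {m} → IsHigh m → ∃₂ λ t s → h t s ≡ m
    h-onto {m} (A∣r , B∣q , m<K*K) = fromℕ< t<B , fromℕ< s<A , (begin
      toℕ (fromℕ< t<B) * A + toℕ (fromℕ< s<A) * B * K
        ≡⟨ cong₂ (λ t s → t * A + s * B * K) (toℕ-fromℕ< t<B) (toℕ-fromℕ< s<A) ⟩
      m % K / A * A + m / K / B * B * K
        ≡⟨ cong₂ (λ r q → r + q * K) (m/n*n≡m A∣r) (m/n*n≡m B∣q) ⟩
      m % K + m / K * K
        ≡⟨ m≡m%n+[m/n]*n m K ⟨
      m ∎)
      where
      t<B : m % K / A < B
      t<B = m<n*o⇒m/o<n (subst (m % K <_) (sym B*A≡K) (m%n<n m K))
      s<A : m / K / B < A
      s<A = m<n*o⇒m/o<n (subst (m / K <_) (sym A*B≡K) (m<n*o⇒m/o<n m<K*K))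
    h-injective : ∀ {t s t′ s′} → h t s ≡ h t′ s′ → t ≡ t′ × s ≡ s′
    h-injective {t} {s} {t′} {s′} eq with digits-injective (*A<K (toℕ<n t)) (*A<K (toℕ<n t′)) eq
    ... | tA≡t′A , sB≡s′B = toℕ-injective (*-cancelʳ-≡ (toℕ t) (toℕ t′) A tA≡t′A) ,
                            toℕ-injective (*-cancelʳ-≡ (toℕ s) (toℕ s′) B sB≡s′B)

  toℕ-−ₙ : ∀ x y → toℕ (x -ₙ y) ≡ suc (toℕ x + neg y) % n
  toℕ-−ₙ x y = begin
    toℕ (x -ₙ y)              ≡⟨ toℕ-fromℕ< _ ⟩
    (toℕ x + (n ∸ toℕ y)) % n ≡⟨ cong (λ t → (toℕ x + t) % n) n∸y ⟩
    (toℕ x + suc (neg y)) % n ≡⟨ cong (_% n) (+-suc (toℕ x) (neg y)) ⟩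
    suc (toℕ x + neg y) % n   ∎
    where
    open ≡-Reasoning
    n∸y : n ∸ toℕ y ≡ suc (neg y)
    n∸y = trans (+-∸-assoc 1 (toℕ≤pred[n] y)) (cong suc (sym (neg≡K*K∸toℕ y)))

  toℕ-low−high : ∀ x y → IsLow (toℕ x) → IsHigh (neg y) → toℕ (x -ₙ y) ≡ suc (toℕ x + neg y)
  toℕ-low−high x y low high = trans (toℕ-−ₙ x y) (m<n⇒m%n≡m (s≤s (low+high<K*K low high)))

  toℕ-high−low : ∀ x y → IsHigh (neg x) → IsLow (toℕ y) → toℕ (x -ₙ y) ≡ K * K ∸ (toℕ y + neg x)
  toℕ-high−low x y high low = begin
    toℕ (x -ₙ y)
      ≡⟨ toℕ-−ₙ x y ⟩
    suc (toℕ x + neg y) % n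
      ≡⟨ cong₂ (λ u v → suc (u + v) % n) (toℕ≡K*K∸neg x) (neg≡K*K∸toℕ y) ⟩
    suc ((K * K ∸ neg x) + (K * K ∸ toℕ y)) % n
      ≡⟨ cong (_% n) (∸+∸-wrap {K * K} {toℕ y} {neg x} (<⇒≤ (low+high<K*K low high))) ⟩
    (K * K ∸ (toℕ y + neg x) + n) % n
      ≡⟨ [m+n]%n≡m%n (K * K ∸ (toℕ y + neg x)) n ⟩
    (K * K ∸ (toℕ y + neg x)) % n
      ≡⟨ m<n⇒m%n≡m (s≤s (m∸n≤m (K * K) (toℕ y + neg x))) ⟩
    K * K ∸ (toℕ y + neg x) ∎
    where open ≡-Reasoning

  Splits : ℕ → Fin n → Fin n → Set
  Splits E x y = IsLow (toℕ x) × IsHigh (neg y) × toℕ x + neg y ≡ E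

  splits-uniquely : ∀ {E} → E < K * K → ∃! _≡_ (uncurry (Splits E))
  splits-uniquely {E} E<K*K = (x₀ , y₀) , (low₀ , high₀ , sum₀) , unique
    where
    lowPart<n : lowPart E < n
    lowPart<n = m<n⇒m<1+n (isLow⇒<K*K (lowPart-isLow E))
    highPart<n : highPart E < n
    highPart<n = m<n⇒m<1+n (proj₂ (proj₂ (highPart-isHigh E<K*K)))
    x₀ y₀ : Fin n
    x₀ = fromℕ< lowPart<n
    y₀ = opposite (fromℕ< highPart<n)
    toℕx₀ : toℕ x₀ ≡ lowPart E
    toℕx₀ = toℕ-fromℕ< lowPart<n
    negy₀ : neg y₀ ≡ highPart E
    negy₀ = trans (cong toℕ (opposite-involutive _)) (toℕ-fromℕ< highPart<n)
    low₀ : IsLow (toℕ x₀)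
    low₀ = subst IsLow (sym toℕx₀) (lowPart-isLow E)
    high₀ : IsHigh (neg y₀)
    high₀ = subst IsHigh (sym negy₀) (highPart-isHigh E<K*K)
    sum₀ : toℕ x₀ + neg y₀ ≡ E
    sum₀ = trans (cong₂ _+_ toℕx₀ negy₀) (lowPart+highPart E)
    unique : ∀ {xy} → uncurry (Splits E) xy → (x₀ , y₀) ≡ xy
    unique {x , y} (low , high , sum) with low+high-unique low₀ high₀ low high (trans sum₀ (sym sum))
    ... | x₀≡x , y₀≡y = cong₂ _,_ (toℕ-injective x₀≡x) (neg-injective y₀≡y)

  inOthers-Low : ∀ y → inOthers family zero y ≡ lookup High y
  inOthers-Low y = ∨-identityʳ _

  inOthers-High : ∀ y → inOthers family (suc zero) y ≡ lookup Low y
  inOthers-High y = ∨-identityʳ _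

  external-Low : ∀ (d : Fin n) → d ≢ 0ₙ → diffCount Low (inOthers family zero) d ≡ 1
  external-Low d d≢0 with toℕ d in toℕd≡
  ... | zero  = contradiction (toℕ-injective toℕd≡) d≢0
  ... | suc E = trans (diffCount≡∑∑ Low _ d) (∑∑-ind≡1 _ pairs⇔ (splits-uniquely E<K*K))
    where
    E<K*K : E < K * K
    E<K*K = subst (_≤ K * K) toℕd≡ (toℕ≤pred[n] d)
    pairs⇔ : ∀ x y → lookup Low x ∧ inOthers family zero y ∧ ⌊ (x -ₙ y) ≟ d ⌋ ≡ true ⇔ Splits E x y
    pairs⇔ x y = mk⇔
      (λ g → let x∈ , y∈ , x−y≡d = to (∧∧⌊⌋≡true⇔ ((x -ₙ y) ≟ d)) g
                 low  = to (∈Low⇔ x) x∈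
                 high = to (∈High⇔ y) (trans (sym (inOthers-Low y)) y∈)
             in low , high , suc-injective (trans (sym (toℕ-low−high x y low high))
                                                  (trans (cong toℕ x−y≡d) toℕd≡)))
      (λ (low , high , sum) → from (∧∧⌊⌋≡true⇔ ((x -ₙ y) ≟ d))
        ( from (∈Low⇔ x) low
        , trans (inOthers-Low y) (from (∈High⇔ y) high)
        , toℕ-injective (trans (toℕ-low−high x y low high) (trans (cong suc sum) (sym toℕd≡)))))

  external-High : ∀ (d : Fin n) → d ≢ 0ₙ → diffCount High (inOthers family (suc zero)) d ≡ 1
  external-High d d≢0 =
    trans (diffCount≡∑∑ High _ d) (∑∑-ind≡1 _ pairs⇔ (flip-unique (splits-uniquely E<K*K)))
    where
    E = K * K ∸ toℕ d
    d≤K*K : toℕ d ≤ K * K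
    d≤K*K = toℕ≤pred[n] d
    E<K*K : E < K * K
    E<K*K = ∸-monoʳ-< (n≢0⇒n>0 (d≢0 ∘ toℕ-injective)) d≤K*K
    flip-unique : ∃! _≡_ (uncurry (Splits E)) → ∃! _≡_ (uncurry (flip (Splits E)))
    flip-unique ((y₀ , x₀) , s₀ , unique) = (x₀ , y₀) , s₀ , λ s → cong swap (unique s)
    pairs⇔ : ∀ x y → lookup High x ∧ inOthers family (suc zero) y ∧ ⌊ (x -ₙ y) ≟ d ⌋ ≡ true ⇔ Splits E y x
    pairs⇔ x y = mk⇔
      (λ g → let x∈ , y∈ , x−y≡d = to (∧∧⌊⌋≡true⇔ ((x -ₙ y) ≟ d)) g
                 high = to (∈High⇔ x) x∈
                 low  = to (∈Low⇔ y) (trans (sym (inOthers-High y)) y∈)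
             in low , high , trans (sym (m∸[m∸n]≡n (<⇒≤ (low+high<K*K low high))))
                                   (cong (K * K ∸_) (trans (sym (toℕ-high−low x y high low)) (cong toℕ x−y≡d))))
      (λ (low , high , sum) → from (∧∧⌊⌋≡true⇔ ((x -ₙ y) ≟ d))
        ( from (∈High⇔ x) high
        , trans (inOthers-High y) (from (∈Low⇔ y) low)
        , toℕ-injective (trans (toℕ-high−low x y high low) (trans (cong (K * K ∸_) sum) (m∸[m∸n]≡n d≤K*K)))))

  isSEDF : IsSEDF n 2 K 1 family
  isSEDF = record { two≤m = ≤-refl ; disjoint = disjoint ; size = size ; external = external }
    where
    disjoint : ∀ i j → i ≢ j → ∀ x → lookup (family i) x ≡ true → lookup (family j) x ≡ false
    disjoint zero       zero       i≢j = contradiction refl i≢j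
    disjoint zero       (suc zero) _   x x∈Low  = ¬-not (Low∩High≡∅ x x∈Low)
    disjoint (suc zero) zero       _   x x∈High = ¬-not (λ x∈Low → Low∩High≡∅ x x∈Low x∈High)
    disjoint (suc zero) (suc zero) i≢j = contradiction refl i≢j
    size : ∀ i → ∣ family i ∣ ≡ K
    size zero       = ∣Low∣≡K
    size (suc zero) = ∣High∣≡K
    external : ∀ i d → d ≢ 0ₙ → diffCount (family i) (inOthers family i) d ≡ 1
    external zero       = external-Low
    external (suc zero) = external-High

  module _ (2≤A : 2 ≤ A) (2≤B : 2 ≤ B) where

    Low≢affineImage : ∀ {u c} → Coprime u n → (S : Subset n) (X : ℕ → ℕ) →
                      (∀ s → s < K → Σ (Fin n) λ x → toℕ x ≡ X s × lookup S x ≡ true) →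
                      X 1 ≢ X 0 → (∀ s → 2 + s < K → X (2 + s) + X s ≡ X (1 + s) + X (1 + s)) →
                      Low ≢ affineImage u c S
    Low≢affineImage {u} {c} u⊥n S X enumerate X₁≢X₀ X-AP Low≡ =
      X₁≢X₀ (affine-injective u⊥n (X<n 1 1<K) (X<n 0 0<K) (low-AP-constant 2≤A 2≤B Z Z-low Z-AP))
      where
      Z : ℕ → ℕ
      Z s = (u * X s + toℕ c) % n
      0<K : 0 < K
      0<K = >-nonZero⁻¹ K
      1<K : 1 < K
      1<K = ≤-trans 2≤A (≤-trans (m≤m+n A A) (A+A≤K 2≤A 2≤B))
      X<n : ∀ s → s < K → X s < n
      X<n s s<K = let x , toℕx≡ , _ = enumerate s s<K in subst (_< n) toℕx≡ (toℕ<n x)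
      Z-low : ∀ s → s < K → IsLow (Z s)
      Z-low s s<K = subst IsLow (toℕ-fromℕ< _) (to (∈Low⇔ z) (trans (cong (λ T → lookup T z) Low≡) z∈image))
        where
        x = proj₁ (enumerate s s<K)
        z = (u * X s + toℕ c) mod n
        z∈image : lookup (affineImage u c S) z ≡ true
        z∈image = subst (λ t → lookup (affineImage u c S) ((u * t + toℕ c) mod n) ≡ true)
                        (proj₁ (proj₂ (enumerate s s<K)))
                        (affineImage-∋ u c S x (proj₂ (proj₂ (enumerate s s<K))))
      -- Two low numbers sum to less than n, so reducing modulo n loses nothing.
      Z-AP : ∀ s → 2 + s < K → Z (2 + s) + Z s ≡ Z (1 + s) + Z (1 + s)
      Z-AP s 2+s<K = begin
        Z (2 + s) + Z s             ≡⟨ m<n⇒m%n≡m (m<n⇒m<1+n (low+low<K*K 2≤A 2≤B (Z-low _ 2+s<K) (Z-low s s<K))) ⟨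
        (Z (2 + s) + Z s) % n       ≡⟨ affine-respects-sums u (toℕ c) (X-AP s 2+s<K) ⟩
        (Z (1 + s) + Z (1 + s)) % n ≡⟨ m<n⇒m%n≡m (m<n⇒m<1+n (low+low<K*K 2≤A 2≤B (Z-low _ 1+s<K) (Z-low _ 1+s<K))) ⟩
        Z (1 + s) + Z (1 + s)       ∎
        where
        open ≡-Reasoning
        1+s<K : 1 + s < K
        1+s<K = <-trans (n<1+n (1 + s)) 2+s<K
        s<K : s < K
        s<K = <-trans (n<1+n s) 1+s<K

-- Inequivalence of the classical and the proper construction

module Inequivalence (K A B : ℕ) {{_ : NonZero K}} {{_ : NonZero A}} {{_ : NonZero B}}
                     (A*B≡K : A * B ≡ K) (2≤A : 2 ≤ A) (2≤B : 2 ≤ B) where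

  module Classical = Construction K 1 K (*-identityˡ K)
  module Proper    = Construction K A B A*B≡K

  open Proper using (n)

  K≤K*K : K ≤ K * K
  K≤K*K = m≤m*n K K

  multiples : ∀ s → s < K → Σ (Fin n) λ x → toℕ x ≡ s * K × lookup Classical.Low x ≡ true
  multiples s s<K = fromℕ< sK<n , toℕ-fromℕ< sK<n ,
    from (Classical.∈Low⇔ (fromℕ< sK<n)) (subst Classical.IsLow (sym (toℕ-fromℕ< sK<n)) (Classical.digits-isLow z<s s<K))
    where
    sK<n : s * K < n
    sK<n = m<n⇒m<1+n (*-monoˡ-< K s<K)

  multiples-AP : ∀ s → 2 + s < K → (2 + s) * K + s * K ≡ (1 + s) * K + (1 + s) * K
  multiples-AP s _ = distribute s K
    where
    distribute : ∀ s K → (2 + s) * K + s * K ≡ (1 + s) * K + (1 + s) * K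
    distribute = solve-∀

  complements : ∀ s → s < K → Σ (Fin n) λ x → toℕ x ≡ K * K ∸ s × lookup Classical.High x ≡ true
  complements s s<K = opposite (fromℕ< s<n) ,
    trans (Classical.neg≡K*K∸toℕ (fromℕ< s<n)) (cong (K * K ∸_) (toℕ-fromℕ< s<n)) ,
    from (Classical.∈High⇔ (opposite (fromℕ< s<n))) (subst Classical.IsHigh s≡neg (Classical.digits-isHigh s<K z<s))
    where
    s<n : s < n
    s<n = m<n⇒m<1+n (<-≤-trans s<K K≤K*K)
    s≡neg : s * 1 + 0 ≡ Classical.neg (opposite (fromℕ< s<n))
    s≡neg = trans (trans (+-identityʳ (s * 1)) (*-identityʳ s))
                  (sym (trans (cong toℕ (opposite-involutive _)) (toℕ-fromℕ< s<n)))

  classical≉proper : ¬ Equivalent Classical.family Proper.family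
  classical≉proper (u , u⊥n , c , σ , images) with σ ⟨$⟩ʳ zero | images zero
  ... | zero     | Low≡ = Proper.Low≢affineImage 2≤A 2≤B u⊥n Classical.Low (_* K) multiples
                            (λ K≡0 → <-irrefl (sym K≡0) (≤-trans (>-nonZero⁻¹ K) (m≤m+n K 0)))
                            multiples-AP Low≡
  ... | suc zero | Low≡ = Proper.Low≢affineImage 2≤A 2≤B u⊥n Classical.High (K * K ∸_) complements
                            (<⇒≢ (∸-monoʳ-< z<s (≤-trans (>-nonZero⁻¹ K) K≤K*K)))
                            (λ s 2+s<K → ∸-AP s (≤-trans (<⇒≤ 2+s<K) K≤K*K)) Low≡

composite⇒product : ∀ {k} → Composite k → ∃₂ λ A B → 2 ≤ A × 2 ≤ B × A * B ≡ k
composite⇒product (hasNonTrivialDivisor {d} d<k d∣k) =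
  quotient d∣k , d , quotient>1 d∣k d<k , nonTrivial⇒n>1 d , sym (m∣n⇒n≡quotient*m d∣k)

theorem5p5 : (k : ℕ) → Composite k →
    Σ (Fin 2 → Subset (suc (k * k))) λ F → Σ (Fin 2 → Subset (suc (k * k))) λ G →
      IsSEDF (suc (k * k)) 2 k 1 F × IsSEDF (suc (k * k)) 2 k 1 G × ¬ Equivalent F G
theorem5p5 k k-composite with composite⇒product k-composite
... | A , B , 2≤A , 2≤B , A*B≡k =
  Classical.family , Proper.family , Classical.isSEDF , Proper.isSEDF , classical≉proper
  where
  instance
    A≢0 : NonZero A
    A≢0 = >-nonZero (<-trans z<s 2≤A)
    B≢0 : NonZero B
    B≢0 = >-nonZero (<-trans z<s 2≤B)
    k≢0 : NonZero k
    k≢0 = subst NonZero A*B≡k (m*n≢0 A B)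
  open Inequivalence k A B A*B≡k 2≤A 2≤B
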